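{- For every $U\in\mathbb U$, $[U]_f=[U]_\beta$.
   Context: Terms: $\mathcal M$ is the set of untyped $\lambda$-terms over a denumerably infinite set of variables, modulo $\alpha$-conversion. $\rhd_\beta$ is the compatible closure of $(\lambda x.M)N\rhd_\beta M[x:=N]$. Weak head reduction: $M\rhd_f N$ iff $M=(\lambda x.P)QQ_1\dots Q_n$ and $N=P[x:=Q]Q_1\dots Q_n$ for some $n\ge 0$. $\rhd_r^*$ is the reflexive-transitive closure of $\rhd_r$. Types: $\mathcal A$ is a denumerably infinite set of atomic types; $\mathbb T::=a\mid \mathbb U\to\mathbb T$ ($a\in\mathcal A$) and $\mathbb U::=\omega\mid \mathbb U\sqcap\mathbb U\mid \mathbb T$; types are quotiented by commutativity, associativity and idempotence of $\sqcap$ and by $\omega\sqcap U=U$. Semantics: for $\mathcal X,\mathcal Y\subseteq\mathcal M$, $\mathcal X\leadsto\mathcal Y=\{M\in\mathcal M\mid MN\in\mathcal Y\text{ for all }N\in\mathcal X\}$. For $r\in\{f,\beta\}$, $\mathcal X$ is $r$-saturated if $M\rhd_r^*N$ and $N\in\mathcal X$ imply $M\in\mathcal X$. An $r$-interpretation is a function $\mathcal I:\mathcal A\to\mathcal P(\mathcal M)$ with every $\mathcal I(a)$ $r$-saturated, extended to $\mathbb U$ by $\mathcal I(\omega)=\mathcal M$, $\mathcal I(U_1\sqcap U_2)=\mathcal I(U_1)\cap\mathcal I(U_2)$, $\mathcal I(U\to T)=\mathcal I(U)\leadsto\mathcal I(T)$. The meaning of $U$ is $[U]_r=\bigcap\{\mathcal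 I(U)\mid \mathcal I\text{ an }r\text{ -interpretation}\}$. -}

module Defs where

open import Level using (Level; 0ℓ) renaming (suc to lsuc)
open import Data.Unit using (⊤)
open import Data.Nat using (ℕ; zero; suc)
open import Data.List using (List; []; _∷_; foldl)
open import Relation.Unary using (Pred; _∩_; _≐_)
open import Relation.Binary.Construct.Closure.ReflexiveTransitive using (Star)

-- Untyped λ-terms modulo α-conversion: de Bruijn indices.

infixl 7 _·_
data Term : Set where
  var : ℕ → Term
  ƛ_  : Term → Term
  _·_ : Term → Term → Term

ext : (ℕ → ℕ) → (ℕ → ℕ)
ext ρ zero    = zero
ext ρ (suc n) = suc (ρ n)

rename : (ℕ → ℕ) → Term → Term
rename ρ (var n) = var (ρ n)
rename ρ (ƛ M)   = ƛ rename (ext ρ) M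
rename ρ (M · N) = rename ρ M · rename ρ N

exts : (ℕ → Term) → (ℕ → Term)
exts σ zero    = var zero
exts σ (suc n) = rename suc (σ n)

subst : (ℕ → Term) → Term → Term
subst σ (var n) = σ n
subst σ (ƛ M)   = ƛ subst (exts σ) M
subst σ (M · N) = subst σ M · subst σ N

-- single substitution  M [ N ]  =  M[x := N]  where x is the bound variable 0
sub0 : Term → ℕ → Term
sub0 N zero    = N
sub0 N (suc n) = var n

_[_] : Term → Term → Term
M [ N ] = subst (sub0 N) M

apps : Term → List Term → Term
apps M Qs = foldl _·_ M Qs

data _▷β_ : Term → Term → Set where
  β    : ∀ {P Q} → ((ƛ P) · Q) ▷β (P [ Q ])
  ξ-ƛ  : ∀ {M N} → M ▷β N → (ƛ M) ▷β (ƛ N)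
  ξ-·ₗ : ∀ {M N P} → M ▷β N → (M · P) ▷β (N · P)
  ξ-·ᵣ : ∀ {M N P} → M ▷β N → (P · M) ▷β (P · N)

data _▷f_ : Term → Term → Set where
  whead : ∀ P Q (Qs : List Term) → apps ((ƛ P) · Q) Qs ▷f apps (P [ Q ]) Qs

Atom : Set
Atom = ℕ

mutual
  data 𝕋 : Set where
    atom : Atom → 𝕋
    _⇒_  : 𝕌 → 𝕋 → 𝕋

  data 𝕌 : Set where
    ω   : 𝕌
    _⊓_ : 𝕌 → 𝕌 → 𝕌
    ⌜_⌝ : 𝕋 → 𝕌

_↝_ : Pred Term 0ℓ → Pred Term 0ℓ → Pred Term 0ℓ
(X ↝ Y) M = ∀ N → X N → Y (M · N)

data Red : Set where
  f β' : Red

_▷[_]_ : Term → Red → Term → Set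
M ▷[ f ]  N = M ▷f N
M ▷[ β' ] N = M ▷β N

_▷[_]*_ : Term → Red → Term → Set
M ▷[ r ]* N = Star (λ A B → A ▷[ r ] B) M N

Saturated : Red → Pred Term 0ℓ → Set
Saturated r X = ∀ M N → M ▷[ r ]* N → X N → X M

record Interpretation (r : Red) : Set₁ where
  field
    ℐ   : Atom → Pred Term 0ℓ
    sat : ∀ a → Saturated r (ℐ a)

open Interpretation public

mutual
  ⟦_⟧𝕋 : ∀ {r} → 𝕋 → Interpretation r → Pred Term 0ℓ
  ⟦ atom a ⟧𝕋 I = ℐ I a
  ⟦ U ⇒ T ⟧𝕋 I = ⟦ U ⟧𝕌 I ↝ ⟦ T ⟧𝕋 I

  ⟦_⟧𝕌 : ∀ {r} → 𝕌 → Interpretation r → Pred Term 0ℓ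
  ⟦ ω ⟧𝕌 I = λ _ → ⊤
  ⟦ U₁ ⊓ U₂ ⟧𝕌 I = ⟦ U₁ ⟧𝕌 I ∩ ⟦ U₂ ⟧𝕌 I
  ⟦ ⌜ T ⌝ ⟧𝕌 I = ⟦ T ⟧𝕋 I

[_]_ : 𝕌 → Red → Pred Term (lsuc 0ℓ)
([ U ] r) M = (I : Interpretation r) → ⟦ U ⟧𝕌 I M

module Submission where

-- Inclusion [U]_f ⊆ [U]_β is the easy half: weak head reduction is a special
-- case of β-reduction, so every β-interpretation is also an f-interpretation,
-- and the meaning of a type only depends on the sets assigned to the atoms.
--
-- For [U]_β ⊆ [U]_f we go through an intersection type system with
-- subsumption (⊢), following the paper:
--   * soundness: if Γ ⊢ M : U, then M lies in I(U) for every f-interpretation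
--     I, provided the free variables of M are realised (only weak head
--     expansion is used, in the abstraction case);
--   * completeness: in the term model J_B(a) = { M | B ⊢ M : a }, which is
--     β-saturated by subject expansion, membership in J_B(U) coincides with
--     typability at U, provided B declares a variable for every arrow domain
--     occurring in U.
-- Given M ∈ [U]_β we type M in a context that gives its free variables the
-- type ω and declares the domains of U on fresh variables; soundness then
-- puts M in I(U) for every f-interpretation I.

open import Defs
open import Relation.Unary using (_≐_; _∩_)
open import Function.Bundles using (_⇔_; mk⇔; module Equivalence)
open import Data.Nat using (ℕ; zero; suc; _<_; _⊔_; s≤s) renaming (_≤_ to _≤ℕ_)
open import Data.Nat.Properties using (<-≤-trans; n<1+n; n≤1+n; m≤m⊔n; m≤n⊔m)
open import Data.List using (List; []; _∷_; _++_; replicate)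
open import Data.List.Membership.Propositional using (_∈_)
open import Data.List.Relation.Unary.Any using (here; there)
open import Data.List.Membership.Propositional.Properties using (∈-++⁺ˡ; ∈-++⁺ʳ)
open import Data.Product using (Σ; _×_; _,_; proj₁; proj₂)
open import Data.Empty using (⊥-elim)
open import Data.Unit using (tt)
open import Relation.Nullary using (¬_)
open import Relation.Binary.PropositionalEquality
  using (_≡_; refl; sym; trans; cong; cong₂; subst₂)
  renaming (subst to transport)
open import Relation.Binary.Construct.Closure.ReflexiveTransitive using (ε; _◅_)

Subst : Set
Subst = ℕ → Term

ext-cong : ∀ {ρ ρ' : ℕ → ℕ} → (∀ x → ρ x ≡ ρ' x) → ∀ x → ext ρ x ≡ ext ρ' x
ext-cong h zero    = refl
ext-cong h (suc x) = cong suc (h x)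

rename-cong : ∀ {ρ ρ' : ℕ → ℕ} → (∀ x → ρ x ≡ ρ' x) → ∀ M → rename ρ M ≡ rename ρ' M
rename-cong h (var x) = cong var (h x)
rename-cong h (ƛ M)   = cong ƛ_ (rename-cong (ext-cong h) M)
rename-cong h (M · N) = cong₂ _·_ (rename-cong h M) (rename-cong h N)

exts-cong : ∀ {σ τ : Subst} → (∀ x → σ x ≡ τ x) → ∀ x → exts σ x ≡ exts τ x
exts-cong h zero    = refl
exts-cong h (suc x) = cong (rename suc) (h x)

subst-cong : ∀ {σ τ : Subst} → (∀ x → σ x ≡ τ x) → ∀ M → subst σ M ≡ subst τ M
subst-cong h (var x) = h x
subst-cong h (ƛ M)   = cong ƛ_ (subst-cong (exts-cong h) M)
subst-cong h (M · N) = cong₂ _·_ (subst-cong h M) (subst-cong h N)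

rename-rename : ∀ ρ ρ' M → rename ρ (rename ρ' M) ≡ rename (λ x → ρ (ρ' x)) M
rename-rename ρ ρ' (var x) = refl
rename-rename ρ ρ' (ƛ M)   =
  cong ƛ_ (trans (rename-rename (ext ρ) (ext ρ') M) (rename-cong ext-fuse M))
  where
  ext-fuse : ∀ x → ext ρ (ext ρ' x) ≡ ext (λ x → ρ (ρ' x)) x
  ext-fuse zero    = refl
  ext-fuse (suc x) = refl
rename-rename ρ ρ' (M · N) = cong₂ _·_ (rename-rename ρ ρ' M) (rename-rename ρ ρ' N)

subst-rename : ∀ τ ρ M → subst τ (rename ρ M) ≡ subst (λ x → τ (ρ x)) M
subst-rename τ ρ (var x) = refl
subst-rename τ ρ (ƛ M)   =
  cong ƛ_ (trans (subst-rename (exts τ) (ext ρ) M) (subst-cong exts-ext M))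
  where
  exts-ext : ∀ x → exts τ (ext ρ x) ≡ exts (λ x → τ (ρ x)) x
  exts-ext zero    = refl
  exts-ext (suc x) = refl
subst-rename τ ρ (M · N) = cong₂ _·_ (subst-rename τ ρ M) (subst-rename τ ρ N)

rename-subst : ∀ ρ σ M → rename ρ (subst σ M) ≡ subst (λ x → rename ρ (σ x)) M
rename-subst ρ σ (var x) = refl
rename-subst ρ σ (ƛ M)   =
  cong ƛ_ (trans (rename-subst (ext ρ) (exts σ) M) (subst-cong ext-exts M))
  where
  ext-exts : ∀ x → rename (ext ρ) (exts σ x) ≡ exts (λ x → rename ρ (σ x)) x
  ext-exts zero    = refl
  ext-exts (suc x) = trans (rename-rename (ext ρ) suc (σ x)) (sym (rename-rename suc ρ (σ x)))
rename-subst ρ σ (M · N) = cong₂ _·_ (rename-subst ρ σ M) (rename-subst ρ σ N)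

subst-subst : ∀ τ σ M → subst τ (subst σ M) ≡ subst (λ x → subst τ (σ x)) M
subst-subst τ σ (var x) = refl
subst-subst τ σ (ƛ M)   =
  cong ƛ_ (trans (subst-subst (exts τ) (exts σ) M) (subst-cong exts-exts M))
  where
  exts-exts : ∀ x → subst (exts τ) (exts σ x) ≡ exts (λ x → subst τ (σ x)) x
  exts-exts zero    = refl
  exts-exts (suc x) = trans (subst-rename (exts τ) suc (σ x)) (sym (rename-subst suc τ (σ x)))
subst-subst τ σ (M · N) = cong₂ _·_ (subst-subst τ σ M) (subst-subst τ σ N)

subst-id : ∀ M → subst var M ≡ M
subst-id (var x) = refl
subst-id (ƛ M)   = cong ƛ_ (trans (subst-cong exts-var M) (subst-id M))
  where
  exts-var : ∀ x → exts var x ≡ var x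
  exts-var zero    = refl
  exts-var (suc x) = refl
subst-id (M · N) = cong₂ _·_ (subst-id M) (subst-id N)

_•_ : Term → Subst → Subst
(N • σ) zero    = N
(N • σ) (suc x) = σ x

exts-[] : ∀ N σ M → (subst (exts σ) M) [ N ] ≡ subst (N • σ) M
exts-[] N σ M = trans (subst-subst (sub0 N) (exts σ) M) (subst-cong sub0-exts M)
  where
  sub0-exts : ∀ x → subst (sub0 N) (exts σ x) ≡ (N • σ) x
  sub0-exts zero    = refl
  sub0-exts (suc x) = trans (subst-rename (sub0 N) suc (σ x)) (subst-id (σ x))

▷β-apps : ∀ {M N} → M ▷β N → ∀ Qs → apps M Qs ▷β apps N Qs
▷β-apps s []       = s
▷β-apps s (Q ∷ Qs) = ▷β-apps (ξ-·ₗ s) Qs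

▷f⇒▷β : ∀ {M N} → M ▷f N → M ▷β N
▷f⇒▷β (whead P Q Qs) = ▷β-apps β Qs

▷f*⇒▷β* : ∀ {M N} → M ▷[ f ]* N → M ▷[ β' ]* N
▷f*⇒▷β* ε        = ε
▷f*⇒▷β* (s ◅ ss) = ▷f⇒▷β s ◅ ▷f*⇒▷β* ss

apps-snoc : ∀ M Qs P → apps M Qs · P ≡ apps M (Qs ++ P ∷ [])
apps-snoc M []       P = refl
apps-snoc M (Q ∷ Qs) P = apps-snoc (M · Q) Qs P

-- Weak head reduction is preserved by applying the term to an argument; this
-- is what makes f-saturation pass through arrow types.
▷f-appˡ : ∀ {M N} → M ▷f N → ∀ R → (M · R) ▷f (N · R)
▷f-appˡ (whead P Q Qs) R =
  subst₂ _▷f_ (sym (apps-snoc ((ƛ P) · Q) Qs R)) (sym (apps-snoc (P [ Q ]) Qs R))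
    (whead P Q (Qs ++ R ∷ []))

▷f*-appˡ : ∀ {M N} → M ▷[ f ]* N → ∀ R → (M · R) ▷[ f ]* (N · R)
▷f*-appˡ ε        R = ε
▷f*-appˡ (s ◅ ss) R = ▷f-appˡ s R ◅ ▷f*-appˡ ss R

-- Components and subtyping.  An intersection U is the set of its components
-- S ∈ᵤ U; U' ≼ U says every component of U is above some component of U'.

infix 4 _∈ᵤ_
data _∈ᵤ_ : 𝕋 → 𝕌 → Set where
  ∈⌜⌝ : ∀ {T} → T ∈ᵤ ⌜ T ⌝
  ∈ˡ  : ∀ {T U V} → T ∈ᵤ U → T ∈ᵤ (U ⊓ V)
  ∈ʳ  : ∀ {T U V} → T ∈ᵤ V → T ∈ᵤ (U ⊓ V)

infix 4 _≤_ _≼_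
mutual
  data _≤_ : 𝕋 → 𝕋 → Set where
    ≤atom  : ∀ {a} → atom a ≤ atom a
    ≤arr   : ∀ {U U' T T'} → U' ≼ U → T ≤ T' → (U ⇒ T) ≤ (U' ⇒ T')
    ≤trans : ∀ {A B C} → A ≤ B → B ≤ C → A ≤ C

  data _≼_ : 𝕌 → 𝕌 → Set where
    ≼ω  : ∀ {U'} → U' ≼ ω
    ≼⊓  : ∀ {U' U₁ U₂} → U' ≼ U₁ → U' ≼ U₂ → U' ≼ (U₁ ⊓ U₂)
    ≼⌜⌝ : ∀ {U' S' S} → S' ∈ᵤ U' → S' ≤ S → U' ≼ ⌜ S ⌝

Below : 𝕌 → 𝕋 → Set
Below U' S = Σ 𝕋 λ S' → S' ∈ᵤ U' × S' ≤ S

≼-lookup : ∀ {U' U S} → U' ≼ U → S ∈ᵤ U → Below U' S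
≼-lookup (≼⌜⌝ p le) ∈⌜⌝    = _ , p , le
≼-lookup (≼⊓ a b)   (∈ˡ p) = ≼-lookup a p
≼-lookup (≼⊓ a b)   (∈ʳ p) = ≼-lookup b p

≼-build : ∀ {U'} U → (∀ S → S ∈ᵤ U → Below U' S) → U' ≼ U
≼-build ω       h = ≼ω
≼-build (U ⊓ V) h = ≼⊓ (≼-build U (λ S p → h S (∈ˡ p))) (≼-build V (λ S p → h S (∈ʳ p)))
≼-build ⌜ T ⌝   h with h T ∈⌜⌝
... | S' , p , le = ≼⌜⌝ p le

mutual
  ≤-refl : ∀ T → T ≤ T
  ≤-refl (atom a) = ≤atom
  ≤-refl (U ⇒ T)  = ≤arr (≼-⊇ U (λ p → p)) (≤-refl T)

  ≼-⊇ : ∀ U {U'} → (∀ {S} → S ∈ᵤ U → S ∈ᵤ U') → U' ≼ U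
  ≼-⊇ ω       h = ≼ω
  ≼-⊇ (U ⊓ V) h = ≼⊓ (≼-⊇ U (λ p → h (∈ˡ p))) (≼-⊇ V (λ p → h (∈ʳ p)))
  ≼-⊇ ⌜ T ⌝   h = ≼⌜⌝ (h ∈⌜⌝) (≤-refl T)

≼-refl : ∀ U → U ≼ U
≼-refl U = ≼-⊇ U (λ p → p)

≼-trans : ∀ {U U₁ U₀} → U ≼ U₁ → U₁ ≼ U₀ → U ≼ U₀
≼-trans {U₀ = U₀} g g' = ≼-build U₀ λ S p → below (≼-lookup g' p)
  where
  below : ∀ {S} → Below _ S → Below _ S
  below (S' , p' , le) with ≼-lookup g p'
  ... | S'' , p'' , le' = S'' , p'' , ≤trans le' le

≤-⇒-inv : ∀ {A U T} → A ≤ (U ⇒ T) →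
          Σ 𝕌 λ U₀ → Σ 𝕋 λ T₀ → (A ≡ (U₀ ⇒ T₀)) × (U ≼ U₀) × (T₀ ≤ T)
≤-⇒-inv (≤arr g t)   = _ , _ , refl , g , t
≤-⇒-inv (≤trans a b) with ≤-⇒-inv b
... | U₁ , T₁ , refl , g , t with ≤-⇒-inv a
... | U₀ , T₀ , eq , g' , t' = U₀ , T₀ , eq , ≼-trans g g' , ≤trans t' t

≤-atom-inv : ∀ {A a} → A ≤ atom a → A ≡ atom a
≤-atom-inv ≤atom        = refl
≤-atom-inv (≤trans a b) with ≤-atom-inv b
... | refl = ≤-atom-inv a

-- The intersection type system.  Contexts assign a type to every variable
-- (ω meaning "unconstrained").

Ctx : Set
Ctx = ℕ → 𝕌

_∷c_ : 𝕌 → Ctx → Ctx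
(U ∷c Γ) zero    = U
(U ∷c Γ) (suc x) = Γ x

_≼c_ : Ctx → Ctx → Set
Δ ≼c Γ = ∀ x → Δ x ≼ Γ x

≼c-ext : ∀ {U' U Δ Γ} → U' ≼ U → Δ ≼c Γ → (U' ∷c Δ) ≼c (U ∷c Γ)
≼c-ext g h zero    = g
≼c-ext g h (suc x) = h x

infix 3 _⊢_∶_ _⊢ₘ_∶_
mutual
  data _⊢_∶_ : Ctx → Term → 𝕋 → Set where
    ax  : ∀ {Γ x T} → T ∈ᵤ Γ x → Γ ⊢ var x ∶ T
    abs : ∀ {Γ M U T} → (U ∷c Γ) ⊢ M ∶ T → Γ ⊢ ƛ M ∶ (U ⇒ T)
    app : ∀ {Γ M N U T} → Γ ⊢ M ∶ (U ⇒ T) → Γ ⊢ₘ N ∶ U → Γ ⊢ M · N ∶ T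
    sub : ∀ {Γ M T T'} → Γ ⊢ M ∶ T → T ≤ T' → Γ ⊢ M ∶ T'

  data _⊢ₘ_∶_ : Ctx → Term → 𝕌 → Set where
    mω  : ∀ {Γ N} → Γ ⊢ₘ N ∶ ω
    m⊓  : ∀ {Γ N U V} → Γ ⊢ₘ N ∶ U → Γ ⊢ₘ N ∶ V → Γ ⊢ₘ N ∶ (U ⊓ V)
    m⌜⌝ : ∀ {Γ N T} → Γ ⊢ N ∶ T → Γ ⊢ₘ N ∶ ⌜ T ⌝

⊢ₘ-component : ∀ {Γ N U S} → Γ ⊢ₘ N ∶ U → S ∈ᵤ U → Γ ⊢ N ∶ S
⊢ₘ-component (m⌜⌝ d)  ∈⌜⌝    = d
⊢ₘ-component (m⊓ a b) (∈ˡ p) = ⊢ₘ-component a p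
⊢ₘ-component (m⊓ a b) (∈ʳ p) = ⊢ₘ-component b p

⊢ₘ-intro : ∀ {Γ N} U → (∀ S → S ∈ᵤ U → Γ ⊢ N ∶ S) → Γ ⊢ₘ N ∶ U
⊢ₘ-intro ω       h = mω
⊢ₘ-intro (U ⊓ V) h = m⊓ (⊢ₘ-intro U (λ S p → h S (∈ˡ p))) (⊢ₘ-intro V (λ S p → h S (∈ʳ p)))
⊢ₘ-intro ⌜ T ⌝   h = m⌜⌝ (h T ∈⌜⌝)

mutual
  ⊢-narrow : ∀ {Γ Δ M T} → Δ ≼c Γ → Γ ⊢ M ∶ T → Δ ⊢ M ∶ T
  ⊢-narrow h (ax {x = x} p) with ≼-lookup (h x) p
  ... | S , q , le = sub (ax q) le
  ⊢-narrow h (abs d)    = abs (⊢-narrow (≼c-ext (≼-refl _) h) d)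
  ⊢-narrow h (app d e)  = app (⊢-narrow h d) (⊢ₘ-narrow h e)
  ⊢-narrow h (sub d le) = sub (⊢-narrow h d) le

  ⊢ₘ-narrow : ∀ {Γ Δ M U} → Δ ≼c Γ → Γ ⊢ₘ M ∶ U → Δ ⊢ₘ M ∶ U
  ⊢ₘ-narrow h mω       = mω
  ⊢ₘ-narrow h (m⊓ a b) = m⊓ (⊢ₘ-narrow h a) (⊢ₘ-narrow h b)
  ⊢ₘ-narrow h (m⌜⌝ d)  = m⌜⌝ (⊢-narrow h d)

var-inv : ∀ {Γ x T} → Γ ⊢ var x ∶ T → Below (Γ x) T
var-inv (ax p)     = _ , p , ≤-refl _
var-inv (sub d le) with var-inv d
... | S , p , le' = S , p , ≤trans le' le

app-inv : ∀ {Γ M N T} → Γ ⊢ M · N ∶ T → Σ 𝕌 λ V → (Γ ⊢ M ∶ (V ⇒ T)) × (Γ ⊢ₘ N ∶ V)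
app-inv (app d e)  = _ , d , e
app-inv (sub d le) with app-inv d
... | V , d' , e = V , sub d' (≤arr (≼-refl V) le) , e

abs-¬atom : ∀ {Γ M a} → ¬ (Γ ⊢ ƛ M ∶ atom a)
abs-¬atom (sub d le) with ≤-atom-inv le
... | refl = abs-¬atom d

abs-inv : ∀ {Γ M U T} → Γ ⊢ ƛ M ∶ (U ⇒ T) → (U ∷c Γ) ⊢ M ∶ T
abs-inv (abs d)    = d
abs-inv (sub d le) with ≤-⇒-inv le
... | U₀ , T₀ , refl , g , t = sub (⊢-narrow (≼c-ext g (λ x → ≼-refl _)) (abs-inv d)) t

mutual
  rename-inv : ∀ {ρ} N {Γ S} → Γ ⊢ rename ρ N ∶ S → (λ y → Γ (ρ y)) ⊢ N ∶ S
  rename-inv (var y) d with var-inv d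
  ... | S' , p , le = sub (ax p) le
  rename-inv (ƛ N) {S = atom a} d = ⊥-elim (abs-¬atom d)
  rename-inv {ρ} (ƛ N) {Γ} {U ⇒ S} d = abs (⊢-narrow ext-ctx (rename-inv N (abs-inv d)))
    where
    ext-ctx : (U ∷c (λ y → Γ (ρ y))) ≼c (λ y → (U ∷c Γ) (ext ρ y))
    ext-ctx zero    = ≼-refl U
    ext-ctx (suc y) = ≼-refl (Γ (ρ y))
  rename-inv (M · N) d with app-inv d
  ... | V , d₁ , e = app (rename-inv M d₁) (rename-invₘ N e)

  rename-invₘ : ∀ {ρ} N {Γ V} → Γ ⊢ₘ rename ρ N ∶ V → (λ y → Γ (ρ y)) ⊢ₘ N ∶ V
  rename-invₘ N mω       = mω
  rename-invₘ N (m⊓ a b) = m⊓ (rename-invₘ N a) (rename-invₘ N b)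
  rename-invₘ N (m⌜⌝ d)  = m⌜⌝ (rename-inv N d)

_⊢ˢ_∶_ : Ctx → Subst → Ctx → Set
Γ ⊢ˢ σ ∶ Δ = ∀ x S → S ∈ᵤ Δ x → Γ ⊢ σ x ∶ S

singleton : ℕ → 𝕌 → Ctx
singleton zero    U zero    = U
singleton zero    U (suc y) = ω
singleton (suc x) U zero    = ω
singleton (suc x) U (suc y) = singleton x U y

singleton-here : ∀ x U → singleton x U x ≡ U
singleton-here zero    U = refl
singleton-here (suc x) U = singleton-here x U

singleton-⊢ˢ : ∀ {Γ} σ x T → Γ ⊢ σ x ∶ T → Γ ⊢ˢ σ ∶ singleton x ⌜ T ⌝
singleton-⊢ˢ σ zero    T d zero    S ∈⌜⌝ = d
singleton-⊢ˢ σ (suc x) T d (suc y) S p   = singleton-⊢ˢ (λ z → σ (suc z)) x T d y S p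

_⊓c_ : Ctx → Ctx → Ctx
(Δ₁ ⊓c Δ₂) x = Δ₁ x ⊓ Δ₂ x

⊓c-≼ˡ : ∀ {Δ₁ Δ₂} → (Δ₁ ⊓c Δ₂) ≼c Δ₁
⊓c-≼ˡ {Δ₁} x = ≼-⊇ (Δ₁ x) ∈ˡ

⊓c-≼ʳ : ∀ {Δ₁ Δ₂} → (Δ₁ ⊓c Δ₂) ≼c Δ₂
⊓c-≼ʳ {Δ₂ = Δ₂} x = ≼-⊇ (Δ₂ x) ∈ʳ

⊓c-⊢ˢ : ∀ {Γ σ Δ₁ Δ₂} → Γ ⊢ˢ σ ∶ Δ₁ → Γ ⊢ˢ σ ∶ Δ₂ → Γ ⊢ˢ σ ∶ (Δ₁ ⊓c Δ₂)
⊓c-⊢ˢ o₁ o₂ x S (∈ˡ p) = o₁ x S p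
⊓c-⊢ˢ o₁ o₂ x S (∈ʳ p) = o₂ x S p

var-typings-≼ : ∀ {Γ U} V → (∀ S → S ∈ᵤ V → (U ∷c Γ) ⊢ var zero ∶ S) → U ≼ V
var-typings-≼ V h = ≼-build V (λ S p → var-inv (h S p))

head∷tail-≼c : (Δ : Ctx) → (Δ zero ∷c (λ y → Δ (suc y))) ≼c Δ
head∷tail-≼c Δ zero    = ≼-refl _
head∷tail-≼c Δ (suc y) = ≼-refl _

mutual
  subst-inv : ∀ P {σ Γ T} → Γ ⊢ subst σ P ∶ T → Σ Ctx λ Δ → (Δ ⊢ P ∶ T) × (Γ ⊢ˢ σ ∶ Δ)
  subst-inv (var x) {σ} {T = T} d =
    singleton x ⌜ T ⌝ , ax (transport (T ∈ᵤ_) (sym (singleton-here x _)) ∈⌜⌝) , singleton-⊢ˢ σ x T d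
  subst-inv (ƛ P) {T = atom a} d = ⊥-elim (abs-¬atom d)
  subst-inv (ƛ P) {σ} {T = U ⇒ T} d with subst-inv P (abs-inv d)
  ... | Δ' , dP , ok =
    (λ y → Δ' (suc y)) ,
    sub (abs (⊢-narrow (head∷tail-≼c Δ') dP))
        (≤arr (var-typings-≼ (Δ' zero) (ok zero)) (≤-refl T)) ,
    (λ y S p → rename-inv (σ y) (ok (suc y) S p))
  subst-inv (P₁ · P₂) d with app-inv d
  ... | V , d₁ , e with subst-inv P₁ d₁ | subst-invₘ P₂ e
  ... | Δ₁ , dP₁ , ok₁ | Δ₂ , eP₂ , ok₂ =
    (Δ₁ ⊓c Δ₂) , app (⊢-narrow ⊓c-≼ˡ dP₁) (⊢ₘ-narrow ⊓c-≼ʳ eP₂) , ⊓c-⊢ˢ ok₁ ok₂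

  subst-invₘ : ∀ P {σ Γ V} → Γ ⊢ₘ subst σ P ∶ V → Σ Ctx λ Δ → (Δ ⊢ₘ P ∶ V) × (Γ ⊢ˢ σ ∶ Δ)
  subst-invₘ P mω = (λ _ → ω) , mω , (λ x S ())
  subst-invₘ P (m⊓ e₁ e₂) with subst-invₘ P e₁ | subst-invₘ P e₂
  ... | Δ₁ , a , ok₁ | Δ₂ , b , ok₂ =
    (Δ₁ ⊓c Δ₂) , m⊓ (⊢ₘ-narrow ⊓c-≼ˡ a) (⊢ₘ-narrow ⊓c-≼ʳ b) , ⊓c-⊢ˢ ok₁ ok₂
  subst-invₘ P (m⌜⌝ d) with subst-inv P d
  ... | Δ , dP , ok = Δ , m⌜⌝ dP , ok

-- Subject expansion: typings are preserved by β-expansion.  For the redex,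
-- the context found for P[Q] is split into the argument's type Δ 0 and a
-- refinement of Γ.
mutual
  subject-expansion : ∀ {M N} → M ▷β N → ∀ {Γ T} → Γ ⊢ N ∶ T → Γ ⊢ M ∶ T
  subject-expansion (β {P}) d with subst-inv P d
  ... | Δ , dP , ok =
    app (abs (⊢-narrow refines dP)) (⊢ₘ-intro (Δ zero) (ok zero))
    where
    refines : (Δ zero ∷c _) ≼c Δ
    refines zero    = ≼-refl _
    refines (suc y) = ≼-build (Δ (suc y)) (λ S p → var-inv (ok (suc y) S p))
  subject-expansion (ξ-ƛ s)  (abs d)    = abs (subject-expansion s d)
  subject-expansion (ξ-·ₗ s) (app d e)  = app (subject-expansion s d) e
  subject-expansion (ξ-·ᵣ s) (app d e)  = app d (subject-expansionₘ s e)
  subject-expansion s        (sub d le) = sub (subject-expansion s d) le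

  subject-expansionₘ : ∀ {M N} → M ▷β N → ∀ {Γ U} → Γ ⊢ₘ N ∶ U → Γ ⊢ₘ M ∶ U
  subject-expansionₘ s mω       = mω
  subject-expansionₘ s (m⊓ a b) = m⊓ (subject-expansionₘ s a) (subject-expansionₘ s b)
  subject-expansionₘ s (m⌜⌝ d)  = m⌜⌝ (subject-expansion s d)

subject-expansion* : ∀ {M N Γ T} → M ▷[ β' ]* N → Γ ⊢ N ∶ T → Γ ⊢ M ∶ T
subject-expansion* ε        d = d
subject-expansion* (s ◅ ss) d = subject-expansion s (subject-expansion* ss d)

mutual
  ⟦⟧𝕋-atoms : ∀ {r r'} {I : Interpretation r} {I' : Interpretation r'} →
              ℐ I ≡ ℐ I' → ∀ T → ⟦ T ⟧𝕋 I ≡ ⟦ T ⟧𝕋 I'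
  ⟦⟧𝕋-atoms e (atom a) = cong (λ ℐ₀ → ℐ₀ a) e
  ⟦⟧𝕋-atoms e (U ⇒ T)  = cong₂ _↝_ (⟦⟧𝕌-atoms e U) (⟦⟧𝕋-atoms e T)

  ⟦⟧𝕌-atoms : ∀ {r r'} {I : Interpretation r} {I' : Interpretation r'} →
              ℐ I ≡ ℐ I' → ∀ U → ⟦ U ⟧𝕌 I ≡ ⟦ U ⟧𝕌 I'
  ⟦⟧𝕌-atoms e ω         = refl
  ⟦⟧𝕌-atoms e (U₁ ⊓ U₂) = cong₂ _∩_ (⟦⟧𝕌-atoms e U₁) (⟦⟧𝕌-atoms e U₂)
  ⟦⟧𝕌-atoms e ⌜ T ⌝     = ⟦⟧𝕋-atoms e T

β⇒f-interpretation : Interpretation β' → Interpretation f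
β⇒f-interpretation J = record
  { ℐ = ℐ J ; sat = λ a M N s → sat J a M N (▷f*⇒▷β* s) }

module _ {r : Red} (I : Interpretation r) where
  ∈ᵤ-sound : ∀ U {M S} → ⟦ U ⟧𝕌 I M → S ∈ᵤ U → ⟦ S ⟧𝕋 I M
  ∈ᵤ-sound ⌜ T ⌝   m       ∈⌜⌝    = m
  ∈ᵤ-sound (U ⊓ V) (m , _) (∈ˡ p) = ∈ᵤ-sound U m p
  ∈ᵤ-sound (U ⊓ V) (_ , m) (∈ʳ p) = ∈ᵤ-sound V m p

  mutual
    ≤-sound : ∀ {T T' M} → T ≤ T' → ⟦ T ⟧𝕋 I M → ⟦ T' ⟧𝕋 I M
    ≤-sound ≤atom        m     = m
    ≤-sound (≤arr g t)   m N n = ≤-sound t (m N (≼-sound g n))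
    ≤-sound (≤trans a b) m     = ≤-sound b (≤-sound a m)

    ≼-sound : ∀ {U' U M} → U' ≼ U → ⟦ U' ⟧𝕌 I M → ⟦ U ⟧𝕌 I M
    ≼-sound ≼ω         m = tt
    ≼-sound (≼⊓ a b)   m = ≼-sound a m , ≼-sound b m
    ≼-sound (≼⌜⌝ p le) m = ≤-sound le (∈ᵤ-sound _ m p)

data Scoped : ℕ → Term → Set where
  sv : ∀ {k x} → x < k → Scoped k (var x)
  sλ : ∀ {k M} → Scoped (suc k) M → Scoped k (ƛ M)
  s· : ∀ {k M N} → Scoped k M → Scoped k N → Scoped k (M · N)

Scoped-mono : ∀ {k k' M} → k ≤ℕ k' → Scoped k M → Scoped k' M
Scoped-mono le (sv lt)  = sv (<-≤-trans lt le)
Scoped-mono le (sλ s)   = sλ (Scoped-mono (s≤s le) s)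
Scoped-mono le (s· a b) = s· (Scoped-mono le a) (Scoped-mono le b)

scope : ∀ M → Σ ℕ λ k → Scoped k M
scope (var x) = suc x , sv (n<1+n x)
scope (ƛ M) with scope M
... | k , s = k , sλ (Scoped-mono (n≤1+n k) s)
scope (M · N) with scope M | scope N
... | k₁ , s₁ | k₂ , s₂ =
  k₁ ⊔ k₂ , s· (Scoped-mono (m≤m⊔n k₁ k₂) s₁) (Scoped-mono (m≤n⊔m k₁ k₂) s₂)

module Soundness (I : Interpretation f) where
  ⟦⟧-saturated : ∀ T → Saturated f (⟦ T ⟧𝕋 I)
  ⟦⟧-saturated (atom a) = sat I a
  ⟦⟧-saturated (U ⇒ T) M N s h P p = ⟦⟧-saturated T (M · P) (N · P) (▷f*-appˡ s P) (h P p)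

  Realises : Ctx → ℕ → Subst → Set
  Realises Γ k σ = ∀ x → x < k → ∀ S → S ∈ᵤ Γ x → ⟦ S ⟧𝕋 I (σ x)

  Realises-• : ∀ {Γ k σ U N} → Realises Γ k σ → ⟦ U ⟧𝕌 I N →
               Realises (U ∷c Γ) (suc k) (N • σ)
  Realises-• {U = U} h n zero    _       S p = ∈ᵤ-sound I U n p
  Realises-• h n       (suc x) (s≤s lt) S p = h x lt S p

  mutual
    sound : ∀ {Γ M T k} → Γ ⊢ M ∶ T → Scoped k M →
            ∀ σ → Realises Γ k σ → ⟦ T ⟧𝕋 I (subst σ M)
    sound (ax p)     (sv lt)    σ h = h _ lt _ p
    sound (abs {M = M} {T = T} d) (sλ s) σ h N n =
      ⟦⟧-saturated T _ _ (whead (subst (exts σ) M) N [] ◅ ε)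
        (transport (⟦ T ⟧𝕋 I) (sym (exts-[] N σ M)) (sound d s (N • σ) (Realises-• h n)))
    sound (app d e)  (s· s₁ s₂) σ h = sound d s₁ σ h _ (soundₘ e s₂ σ h)
    sound (sub d le) s          σ h = ≤-sound I le (sound d s σ h)

    soundₘ : ∀ {Γ M U k} → Γ ⊢ₘ M ∶ U → Scoped k M →
             ∀ σ → Realises Γ k σ → ⟦ U ⟧𝕌 I (subst σ M)
    soundₘ mω       s σ h = tt
    soundₘ (m⊓ a b) s σ h = soundₘ a s σ h , soundₘ b s σ h
    soundₘ (m⌜⌝ d)  s σ h = sound d s σ h

-- The domains U of all arrows U ⇒ T occurring in a type: the completeness
-- argument needs a variable of each of these types.
mutual
  domainsT : 𝕋 → List 𝕌
  domainsT (atom a) = []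
  domainsT (U ⇒ T)  = U ∷ (domainsU U ++ domainsT T)

  domainsU : 𝕌 → List 𝕌
  domainsU ω       = []
  domainsU (U ⊓ V) = domainsU U ++ domainsU V
  domainsU ⌜ T ⌝   = domainsT T

module Completeness (B : Ctx) where
  termModel : Interpretation β'
  termModel = record { ℐ = λ a M → B ⊢ M ∶ atom a ; sat = λ a M N → subject-expansion* }

  Declares : List 𝕌 → Set
  Declares L = ∀ {U} → U ∈ L → Σ ℕ λ x → B x ≡ U

  open Equivalence using (to; from)

  mutual
    completeT : ∀ T → Declares (domainsT T) → ∀ M → ⟦ T ⟧𝕋 termModel M ⇔ (B ⊢ M ∶ T)
    completeT (atom a) dec M = mk⇔ (λ d → d) (λ d → d)
    completeT (U ⇒ T)  dec M = mk⇔ fromMeaning toMeaning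
      where
      decU : Declares (domainsU U)
      decU p = dec (there (∈-++⁺ˡ p))
      decT : Declares (domainsT T)
      decT p = dec (there (∈-++⁺ʳ (domainsU U) p))
      x : ℕ
      x = proj₁ (dec (here refl))
      Bx≡U : B x ≡ U
      Bx≡U = proj₂ (dec (here refl))
      x∶U : B ⊢ₘ var x ∶ U
      x∶U = ⊢ₘ-intro U (λ S p → ax (transport (S ∈ᵤ_) (sym Bx≡U) p))
      x∶V⇒U≼V : ∀ {V} → B ⊢ₘ var x ∶ V → U ≼ V
      x∶V⇒U≼V {V} e =
        ≼-build V (λ S p → transport (λ W → Below W S) Bx≡U (var-inv (⊢ₘ-component e p)))
      toMeaning : B ⊢ M ∶ (U ⇒ T) → ⟦ U ⇒ T ⟧𝕋 termModel M
      toMeaning d N n = from (completeT T decT (M · N)) (app d (to (completeU U decU N) n))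
      -- M x : T, hence M : V ⇒ T with x : V, and U ≼ V
      fromMeaning : ⟦ U ⇒ T ⟧𝕋 termModel M → B ⊢ M ∶ (U ⇒ T)
      fromMeaning m with app-inv (to (completeT T decT (M · var x))
                                   (m (var x) (from (completeU U decU (var x)) x∶U)))
      ... | V , d₁ , e = sub d₁ (≤arr (x∶V⇒U≼V e) (≤-refl T))

    completeU : ∀ U → Declares (domainsU U) → ∀ M → ⟦ U ⟧𝕌 termModel M ⇔ (B ⊢ₘ M ∶ U)
    completeU ω       dec M = mk⇔ (λ _ → mω) (λ _ → tt)
    completeU (U ⊓ V) dec M = mk⇔
      (λ { (a , b) → m⊓ (to (completeU U decU M) a) (to (completeU V decV M) b) })
      (λ { (m⊓ a b) → from (completeU U decU M) a , from (completeU V decV M) b })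
      where
      decU : Declares (domainsU U)
      decU p = dec (∈-++⁺ˡ p)
      decV : Declares (domainsU V)
      decV p = dec (∈-++⁺ʳ (domainsU U) p)
    completeU ⌜ T ⌝   dec M = mk⇔
      (λ m → m⌜⌝ (to (completeT T dec M) m)) (λ { (m⌜⌝ d) → from (completeT T dec M) d })

nth : List 𝕌 → ℕ → 𝕌
nth []      _       = ω
nth (U ∷ L) zero    = U
nth (U ∷ L) (suc n) = nth L n

padded : ℕ → List 𝕌 → Ctx
padded k L = nth (replicate k ω ++ L)

nth-∈ : ∀ {U L} → U ∈ L → Σ ℕ λ i → nth L i ≡ U
nth-∈ (here refl) = zero , refl
nth-∈ (there p) with nth-∈ p
... | i , eq = suc i , eq

padded-declares : ∀ k L {U} → U ∈ L → Σ ℕ λ x → padded k L x ≡ U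
padded-declares k L p = nth-∈ (∈-++⁺ʳ (replicate k ω) p)

padded-ω : ∀ k L x → x < k → padded k L x ≡ ω
padded-ω (suc k) L zero    lt       = refl
padded-ω (suc k) L (suc x) (s≤s lt) = padded-ω k L x lt

[]β⊆[]f : ∀ U M → ([ U ] β') M → ([ U ] f) M
[]β⊆[]f U M m I = transport (⟦ U ⟧𝕌 I) (subst-id M) (Soundness.soundₘ I M∶U Mₛ var realised)
  where
  k : ℕ
  k = proj₁ (scope M)
  Mₛ : Scoped k M
  Mₛ = proj₂ (scope M)
  B : Ctx
  B = padded k (domainsU U)
  M∶U : B ⊢ₘ M ∶ U
  M∶U = Equivalence.to (Completeness.completeU B U (padded-declares k (domainsU U)) M)
                       (m (Completeness.termModel B))
  realised : Soundness.Realises I B k var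
  realised x lt S p with () ← transport (S ∈ᵤ_) (padded-ω k (domainsU U) x lt) p

[]f⊆[]β : ∀ U M → ([ U ] f) M → ([ U ] β') M
[]f⊆[]β U M m J =
  transport (λ P → P M) (⟦⟧𝕌-atoms {I = β⇒f-interpretation J} refl U) (m (β⇒f-interpretation J))

corollary5p3 : ∀ (U : 𝕌) → ([ U ] f) ≐ ([ U ] β')
corollary5p3 U = []f⊆[]β U _ , []β⊆[]f U _
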